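{- We have $m_2(2)=2$, $m_3(3)=5$, and $m_4(4)=14$.
   Context: Fix $k\in\mathbb{N}$ and an alphabet $\mathbb{A}$ of size $k$. A word is \emph{even} if every letter occurs in it an even number of times. For a permutation $\gamma=\gamma_1\cdots\gamma_n$ of $[n]=\{1,\dots,n\}$ (written as a sequence) and a word $W=w_1\cdots w_n$, set $\gamma(W)=w_{\gamma_1}\cdots w_{\gamma_n}$. Two words $U,V$ of length $n$ are \emph{$\gamma$-similar} if $U=\gamma(V)$ or $V=\gamma(U)$. A word $W$ of length $2n$ is a \emph{shuffle $\gamma$-square} (for $\gamma$ a permutation of $[n]$) if its positions can be partitioned into two sets so that the two resulting subwords (letters at those positions, in order), each of length $n$, are $\gamma$-similar. Let $E_n$ be the set of all even words of length $2n$ over $\mathbb{A}$, and $S_n$ the set of all permutations of $[n]$. A set $X\subseteq S_n$ is \emph{covering} if every $W\in E_n$ is a shuffle $\gamma$-square for some $\gamma\in X$. Let $m_k(n)$ denote the minimum size of a covering subset of $S_n$ (for alphabet size $k$). -}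

module Defs where

open import Data.Nat using (ℕ; _+_; _≤_)
open import Data.Nat.Divisibility using (_∣_)
open import Data.Fin using (Fin; _≟_) renaming (_<_ to _<ᶠ_)
open import Data.Vec using (Vec; lookup; map; tabulate; count)
open import Data.List using (List; length)
open import Data.List.Relation.Unary.All using (All)
open import Data.List.Relation.Unary.Any using (Any)
open import Data.List.Relation.Unary.Unique.Propositional using (Unique)
open import Data.Product using (Σ; ∃; _×_; _,_)
open import Data.Sum using (_⊎_)
open import Relation.Binary.PropositionalEquality using (_≡_; _≢_)

Word : ℕ → ℕ → Set
Word k n = Vec (Fin k) n

occ : ∀ {k n} → Fin k → Word k n → ℕ
occ a W = count (_≟ a) W

Even : ∀ {k n} → Word k n → Set
Even {k} W = (a : Fin k) → 2 ∣ occ a W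

-- a permutation of [n] written as a sequence γ₁ ⋯ γₙ (positions 0-indexed: Fin n)
IsPerm : ∀ {n} → Vec (Fin n) n → Set
IsPerm {n} γ = (i j : Fin n) → lookup γ i ≡ lookup γ j → i ≡ j

act : ∀ {k n} → Vec (Fin n) n → Word k n → Word k n
act γ W = map (lookup W) γ

Similar : ∀ {k n} → Vec (Fin n) n → Word k n → Word k n → Set
Similar γ U V = (U ≡ act γ V) ⊎ (V ≡ act γ U)

StrictlyIncreasing : ∀ {n m} → (Fin n → Fin m) → Set
StrictlyIncreasing {n} f = (i j : Fin n) → i <ᶠ j → f i <ᶠ f j

subword : ∀ {k n m} → Word k m → (Fin n → Fin m) → Word k n
subword W f = tabulate (λ i → lookup W (f i))

ShuffleSquare : ∀ {k n} → Vec (Fin n) n → Word k (n + n) → Set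
ShuffleSquare {k} {n} γ W =
  Σ (Fin n → Fin (n + n)) λ f → Σ (Fin n → Fin (n + n)) λ g →
    StrictlyIncreasing f × StrictlyIncreasing g ×
    ((i j : Fin n) → f i ≢ g j) ×
    ((p : Fin (n + n)) → (∃ λ i → f i ≡ p) ⊎ (∃ λ j → g j ≡ p)) ×
    Similar γ (subword W f) (subword W g)

-- a finite subset X ⊆ Sₙ, given as a duplicate-free list of permutations
IsPermSet : ∀ {n} → List (Vec (Fin n) n) → Set
IsPermSet X = All IsPerm X × Unique X

Covering : ℕ → ∀ {n} → List (Vec (Fin n) n) → Set
Covering k {n} X = (W : Word k (n + n)) → Even W → Any (λ γ → ShuffleSquare γ W) X

MinCover : ℕ → ℕ → ℕ → Set
MinCover k n m =
  (Σ (List (Vec (Fin n) n)) λ X → IsPermSet X × Covering k X × length X ≡ m) ×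
  ((X : List (Vec (Fin n) n)) → IsPermSet X → Covering k X → m ≤ length X)

{-# OPTIONS --safe #-}
module Submission where

-- Upper bounds: the given sets of permutations are checked to be covering by exhaustive search
-- over the even words; for n = 4 the letters are first renamed so that the word starts with 00
-- or 01. Lower bounds: we give m_k(n) even words, each a shuffle γ-square only for the
-- permutations γ in its own list of candidates, these lists being pairwise disjoint. A covering
-- set must meet every list, so it has at least m_k(n) elements.

open import Defs
open import Data.Nat using (ℕ; zero; suc; _+_; _≤_; _≤?_; z≤n; s≤s)
open import Data.Nat.Divisibility using (_∣_; _∣?_)
open import Data.Fin using (Fin; zero; suc; toℕ; _≟_) renaming (_<_ to _<ᶠ_)
open import Data.Fin.Properties using (all?; any?; _<?_; injective⇒≤)
open import Data.Fin.Patterns using (0F; 1F; 2F; 3F)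
open import Data.Fin.Permutation using (Permutation′; _⟨$⟩ʳ_; _⟨$⟩ˡ_; inverseˡ; inverseʳ; transpose)
import Data.Fin.Permutation.Components as Components
open import Data.Vec using (Vec; []; _∷_; lookup; map; tabulate)
open import Data.Vec.Properties
  using ( ≡-dec; ∷-injectiveˡ; ∷-injectiveʳ; map-∘; map-cong; map-id; lookup-map
        ; tabulate-∘; tabulate-cong; lookup∘tabulate)
open import Data.List as List using (List; length; []; _∷_)
open import Data.List.Membership.Propositional using (_∈_; _∉_)
open import Data.List.Relation.Unary.All as All using (All)
open import Data.List.Relation.Unary.AllPairs using (allPairs?)
open import Data.List.Relation.Unary.Any as Any using (Any)
open import Data.Bool using (Bool; true; _∧_; T)
open import Data.Bool.Properties using (T-∧)
open import Data.Product using (∃; ∃₂; _×_; _,_; proj₁; proj₂)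
open import Data.Sum as Sum using (_⊎_; inj₁; inj₂)
open import Function using (_∘_; id; Equivalence)
open import Relation.Nullary using (Dec; yes; no; ¬_; ¬?; contradiction)
open import Relation.Nullary.Decidable
  using (map′; _×-dec_; _⊎-dec_; _→-dec_; dec-true; dec-false; isYes; from-yes; toWitness)
open import Relation.Unary using (Decidable)
open import Relation.Binary.PropositionalEquality
  using (_≡_; _≢_; _≗_; refl; sym; trans; cong; cong₂; subst; subst₂; module ≡-Reasoning)

-- Large quantifiers are evaluated on booleans: folding Dec values would keep every component
-- proof, and with it the whole search, in memory until the end.
allFinᵇ : ∀ {n} → (Fin n → Bool) → Bool
allFinᵇ {zero}  p = true
allFinᵇ {suc n} p = p zero ∧ allFinᵇ (p ∘ suc)

allVecᵇ : ∀ {k m} → (Vec (Fin k) m → Bool) → Bool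
allVecᵇ {m = zero}  p = p []
allVecᵇ {m = suc m} p = allFinᵇ λ x → allVecᵇ (p ∘ (x ∷_))

allFinᵇ-sound : ∀ {n} (p : Fin n → Bool) → T (allFinᵇ p) → ∀ i → T (p i)
allFinᵇ-sound p all zero    = proj₁ (Equivalence.to T-∧ all)
allFinᵇ-sound p all (suc i) = allFinᵇ-sound (p ∘ suc) (proj₂ (Equivalence.to T-∧ all)) i

allVecᵇ-sound : ∀ {k m} (p : Vec (Fin k) m → Bool) → T (allVecᵇ p) → ∀ v → T (p v)
allVecᵇ-sound p all []       = all
allVecᵇ-sound p all (x ∷ xs) = allVecᵇ-sound (p ∘ (x ∷_)) (allFinᵇ-sound _ all x) xs

toWitness-allFin : ∀ {n} {P : Fin n → Set} (P? : Decidable P) → T (allFinᵇ (isYes ∘ P?)) →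
                   ∀ i → P i
toWitness-allFin P? all i = toWitness {a? = P? i} (allFinᵇ-sound _ all i)

toWitness-allVec : ∀ {k m} {P : Vec (Fin k) m → Set} (P? : Decidable P) → T (allVecᵇ (isYes ∘ P?)) →
                   ∀ v → P v
toWitness-allVec P? all v = toWitness {a? = P? v} (allVecᵇ-sound _ all v)

even? : ∀ {k m} (W : Word k m) → Dec (Even W)
even? W = all? λ a → 2 ∣? occ a W

isPerm? : ∀ {n} (γ : Vec (Fin n) n) → Dec (IsPerm γ)
isPerm? γ = all? λ i → all? λ j → (lookup γ i ≟ lookup γ j) →-dec (i ≟ j)

isPermSet? : ∀ {n} (X : List (Vec (Fin n) n)) → Dec (IsPermSet X)
isPermSet? X = All.all? isPerm? X ×-dec allPairs? (λ γ δ → ¬? (≡-dec _≟_ γ δ)) X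

_∈?_ : ∀ {k m} (v : Vec (Fin k) m) (X : List (Vec (Fin k) m)) → Dec (v ∈ X)
v ∈? X = Any.any? (≡-dec _≟_ v) X

similar? : ∀ {k n} (γ : Vec (Fin n) n) (U V : Word k n) → Dec (Similar γ U V)
similar? γ U V = ≡-dec _≟_ U (act γ V) ⊎-dec ≡-dec _≟_ V (act γ U)

strictlyIncreasing? : ∀ {n m} (f : Fin n → Fin m) → Dec (StrictlyIncreasing f)
strictlyIncreasing? f = all? λ i → all? λ j → (i <? j) →-dec (f i <? f j)

-- Letter maps and renamings

subword-map : ∀ {k l n m} (σ : Fin k → Fin l) (W : Word k m) (f : Fin n → Fin m) →
              subword (map σ W) f ≡ map σ (subword W f)
subword-map σ W f = trans (tabulate-cong (λ i → lookup-map (f i) σ W)) (tabulate-∘ σ _)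

act-map : ∀ {k l n} (σ : Fin k → Fin l) (γ : Vec (Fin n) n) (V : Word k n) →
          act γ (map σ V) ≡ map σ (act γ V)
act-map σ γ V = trans (map-cong (λ i → lookup-map i σ V) γ) (map-∘ σ (lookup V) γ)

similar-map : ∀ {k l n} (σ : Fin k → Fin l) (γ : Vec (Fin n) n) {U V : Word k n} →
              Similar γ U V → Similar γ (map σ U) (map σ V)
similar-map σ γ {U} {V} (inj₁ U≡γV) = inj₁ (trans (cong (map σ) U≡γV) (sym (act-map σ γ V)))
similar-map σ γ {U} {V} (inj₂ V≡γU) = inj₂ (trans (cong (map σ) V≡γU) (sym (act-map σ γ U)))

shuffleSquare-map : ∀ {k l n} (σ : Fin k → Fin l) (γ : Vec (Fin n) n) (W : Word k (n + n)) →
                    ShuffleSquare γ W → ShuffleSquare γ (map σ W)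
shuffleSquare-map σ γ W (f , g , incf , incg , disjoint , cover , similar) =
  f , g , incf , incg , disjoint , cover ,
  subst₂ (Similar γ) (sym (subword-map σ W f)) (sym (subword-map σ W g)) (similar-map σ γ similar)

rename : ∀ {k m} → Permutation′ k → Word k m → Word k m
rename π = map (π ⟨$⟩ʳ_)

occ-rename : ∀ {k m} (π : Permutation′ k) a (W : Word k m) → occ a (rename π W) ≡ occ (π ⟨$⟩ˡ a) W
occ-rename π a [] = refl
occ-rename π a (w ∷ W) with π ⟨$⟩ʳ w ≟ a | w ≟ π ⟨$⟩ˡ a
... | yes _    | yes _   = cong suc (occ-rename π a W)
... | no _     | no _    = occ-rename π a W
... | yes πw≡a | no w≢a  = contradiction (trans (sym (inverseˡ π)) (cong (π ⟨$⟩ˡ_) πw≡a)) w≢a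
... | no πw≢a  | yes w≡a = contradiction (trans (cong (π ⟨$⟩ʳ_) w≡a) (inverseʳ π)) πw≢a

even-rename : ∀ {k m} (π : Permutation′ k) (W : Word k m) → Even W → Even (rename π W)
even-rename π W even a = subst (2 ∣_) (sym (occ-rename π a W)) (even (π ⟨$⟩ˡ a))

rename-inverse : ∀ {k m} (π : Permutation′ k) (W : Word k m) → map (π ⟨$⟩ˡ_) (rename π W) ≡ W
rename-inverse π W = begin
  map (π ⟨$⟩ˡ_) (map (π ⟨$⟩ʳ_) W)  ≡⟨ sym (map-∘ _ _ W) ⟩
  map (λ x → π ⟨$⟩ˡ (π ⟨$⟩ʳ x)) W  ≡⟨ map-cong (λ _ → inverseˡ π) W ⟩
  map id W                         ≡⟨ map-id W ⟩
  W                                ∎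
  where open ≡-Reasoning

RenamingInvariant : ∀ {k m} → (Word k m → Set) → Set
RenamingInvariant P = ∀ π W → P (rename π W) → P W

transpose-matchˡ : ∀ {n} (i j : Fin n) → Components.transpose i j i ≡ j
transpose-matchˡ i j rewrite dec-true (i ≟ i) refl = refl

transpose-fixes : ∀ {n} {i j k : Fin n} → k ≢ i → k ≢ j → Components.transpose i j k ≡ k
transpose-fixes {i = i} {j} {k} k≢i k≢j rewrite dec-false (k ≟ i) k≢i | dec-false (k ≟ j) k≢j = refl

all-from-initial-0 : ∀ {k m} {P : Word (suc k) (suc m) → Set} → RenamingInvariant P →
                     (∀ R → P (0F ∷ R)) → ∀ W → P W
all-from-initial-0 {P = P} invariant initial-0 (a ∷ R) =
  invariant π (a ∷ R) (subst (λ b → P (b ∷ rename π R)) (sym (transpose-matchˡ a 0F)) (initial-0 _))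
  where π = transpose a 0F

all-initial-0-from-00-01 : ∀ {k m} {P : Word (suc (suc k)) (suc (suc m)) → Set} →
                           RenamingInvariant P → (∀ R → P (0F ∷ 0F ∷ R)) → (∀ R → P (0F ∷ 1F ∷ R)) →
                           ∀ R → P (0F ∷ R)
all-initial-0-from-00-01 {P = P} invariant initial-00 initial-01 (b ∷ R) with b ≟ 0F
... | yes refl = initial-00 R
... | no b≢0 = invariant π (0F ∷ b ∷ R)
  (subst₂ (λ x y → P (x ∷ y ∷ rename π R))
    (sym (transpose-fixes (b≢0 ∘ sym) λ ())) (sym (transpose-matchˡ b 1F)) (initial-01 _))
  where π = transpose b 1F

-- Splitting a word into two subwords

Splitting : ∀ {a b m} → (Fin a → Fin m) → (Fin b → Fin m) → Set
Splitting {m = m} f g =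
  StrictlyIncreasing f × StrictlyIncreasing g × (∀ i j → f i ≢ g j) ×
  ((p : Fin m) → (∃ λ i → f i ≡ p) ⊎ (∃ λ j → g j ≡ p))

splitting? : ∀ {a b m} (f : Fin a → Fin m) (g : Fin b → Fin m) → Dec (Splitting f g)
splitting? f g =
  strictlyIncreasing? f ×-dec strictlyIncreasing? g ×-dec
  (all? λ i → all? λ j → ¬? (f i ≟ g j)) ×-dec
  (all? λ p → any? (λ i → f i ≟ p) ⊎-dec any? (λ j → g j ≟ p))

splitting-cong : ∀ {a b m} {f f′ : Fin a → Fin m} {g g′ : Fin b → Fin m} →
                 f ≗ f′ → g ≗ g′ → Splitting f g → Splitting f′ g′
splitting-cong f≗f′ g≗g′ (incf , incg , disjoint , cover) =
  (λ i j i<j → subst₂ _<ᶠ_ (f≗f′ i) (f≗f′ j) (incf i j i<j)) ,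
  (λ i j i<j → subst₂ _<ᶠ_ (g≗g′ i) (g≗g′ j) (incg i j i<j)) ,
  (λ i j f′i≡g′j → disjoint i j (trans (f≗f′ i) (trans f′i≡g′j (sym (g≗g′ j))))) ,
  λ p → Sum.map (λ (i , fi≡p) → i , trans (sym (f≗f′ i)) fi≡p)
                (λ (j , gj≡p) → j , trans (sym (g≗g′ j)) gj≡p) (cover p)

subword-cong : ∀ {k n m} (W : Word k m) {f f′ : Fin n → Fin m} → f ≗ f′ → subword W f ≡ subword W f′
subword-cong W f≗f′ = tabulate-cong (cong (lookup W) ∘ f≗f′)

Unshuffles : ∀ {k a b m} → Word k m → (Word k a → Word k b → Set) → Set
Unshuffles W Q = ∃₂ λ f g → Splitting f g × Q (subword W f) (subword W g)

unshuffles⇒shuffleSquare : ∀ {k n} {γ : Vec (Fin n) n} {W : Word k (n + n)} →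
                           Unshuffles W (Similar γ) → ShuffleSquare γ W
unshuffles⇒shuffleSquare (f , g , (incf , incg , disjoint , cover) , similar) =
  f , g , incf , incg , disjoint , cover , similar

shuffleSquare⇒unshuffles : ∀ {k n} {γ : Vec (Fin n) n} {W : Word k (n + n)} →
                           ShuffleSquare γ W → Unshuffles W (Similar γ)
shuffleSquare⇒unshuffles (f , g , incf , incg , disjoint , cover , similar) =
  f , g , (incf , incg , disjoint , cover) , similar

AnyIncreasing : ∀ {m r} (avoid : Vec (Fin m) r) (lo n : ℕ) → (Vec (Fin m) n → Set) → Set
AnyIncreasing avoid lo zero    P = P []
AnyIncreasing avoid lo (suc n) P =
  ∃ λ a → lo ≤ toℕ a × (∀ i → lookup avoid i ≢ a) ×
          AnyIncreasing avoid (suc (toℕ a)) n (P ∘ (a ∷_))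

anyIncreasing? : ∀ {m r} (avoid : Vec (Fin m) r) lo n {P : Vec (Fin m) n → Set} →
                 Decidable P → Dec (AnyIncreasing avoid lo n P)
anyIncreasing? avoid lo zero    P? = P? []
anyIncreasing? avoid lo (suc n) P? = any? λ a →
  lo ≤? toℕ a ×-dec (all? λ i → ¬? (lookup avoid i ≟ a)) ×-dec
  anyIncreasing? avoid (suc (toℕ a)) n (P? ∘ (a ∷_))

anyIncreasing-satisfied : ∀ {m r} {avoid : Vec (Fin m) r} {lo} n {P : Vec (Fin m) n → Set} →
                          AnyIncreasing avoid lo n P → ∃ P
anyIncreasing-satisfied zero    p                  = [] , p
anyIncreasing-satisfied (suc n) (a , _ , _ , rest) with anyIncreasing-satisfied n rest
... | v , p = a ∷ v , p

anyIncreasing⁺ : ∀ {m r} {avoid : Vec (Fin m) r} {lo} n {P : Vec (Fin m) n → Set}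
                 (f : Fin n → Fin m) → StrictlyIncreasing f → (∀ i → lo ≤ toℕ (f i)) →
                 (∀ i j → lookup avoid j ≢ f i) → P (tabulate f) → AnyIncreasing avoid lo n P
anyIncreasing⁺ zero    f incf lo≤f avoided p = p
anyIncreasing⁺ (suc n) f incf lo≤f avoided p =
  f zero , lo≤f zero , avoided zero ,
  anyIncreasing⁺ n (f ∘ suc) (λ i j i<j → incf (suc i) (suc j) (s≤s i<j))
    (λ i → incf zero (suc i) (s≤s z≤n)) (avoided ∘ suc) p

-- Avoiding the terms of f only prunes the search for g; that the pair found is a splitting is
-- checked at the leaf, which makes the search trivially sound.
UnshuffleSearch : ∀ {k a b m} → Word k m → (Word k a → Word k b → Set) → Set
UnshuffleSearch {a = a} {b} W Q =
  AnyIncreasing [] 0 a λ fv → AnyIncreasing fv 0 b λ gv →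
    Q (subword W (lookup fv)) (subword W (lookup gv)) × Splitting (lookup fv) (lookup gv)

search⇒unshuffles : ∀ {k a b m} {W : Word k m} {Q : Word k a → Word k b → Set} →
                    UnshuffleSearch W Q → Unshuffles W Q
search⇒unshuffles {a = a} {b} found with anyIncreasing-satisfied a found
... | fv , found-g with anyIncreasing-satisfied b found-g
... | gv , q , splitting = lookup fv , lookup gv , splitting , q

unshuffles⇒search : ∀ {k a b m} {W : Word k m} {Q : Word k a → Word k b → Set} →
                    Unshuffles W Q → UnshuffleSearch W Q
unshuffles⇒search {a = a} {b} {W = W} {Q} (f , g , splitting@(incf , incg , disjoint , _) , q) =
  anyIncreasing⁺ a f incf (λ _ → z≤n) (λ _ ()) (anyIncreasing⁺ b g incg (λ _ → z≤n) g-avoids-f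
    (subst₂ Q (subword-cong W f≗) (subword-cong W g≗) q , splitting-cong f≗ g≗ splitting))
  where
  f≗ : f ≗ lookup (tabulate f)
  f≗ = sym ∘ lookup∘tabulate f
  g≗ : g ≗ lookup (tabulate g)
  g≗ = sym ∘ lookup∘tabulate g
  g-avoids-f : ∀ j i → lookup (tabulate f) i ≢ g j
  g-avoids-f j i fi≡gj = disjoint i j (trans (f≗ i) fi≡gj)

unshuffles? : ∀ {k a b m} (W : Word k m) {Q : Word k a → Word k b → Set} →
              (∀ U V → Dec (Q U V)) → Dec (Unshuffles W Q)
unshuffles? {a = a} {b} W {Q} Q? = map′ (search⇒unshuffles {W = W} {Q}) (unshuffles⇒search {W = W} {Q})
  (anyIncreasing? [] 0 a λ fv → anyIncreasing? fv 0 b λ gv →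
    Q? (subword W (lookup fv)) (subword W (lookup gv)) ×-dec splitting? (lookup fv) (lookup gv))

Covers : ∀ {k n} → List (Vec (Fin n) n) → Word k (n + n) → Set
Covers X W = Even W → Any (λ γ → ShuffleSquare γ W) X

covers-renamingInvariant : ∀ {k n} (X : List (Vec (Fin n) n)) → RenamingInvariant (Covers {k} X)
covers-renamingInvariant X π W covers even = Any.map
  (λ {γ} square → subst (ShuffleSquare γ) (rename-inverse π W)
                         (shuffleSquare-map (π ⟨$⟩ˡ_) γ (rename π W) square))
  (covers (even-rename π W even))

SimilarIn : ∀ {k n} → List (Vec (Fin n) n) → Word k n → Word k n → Set
SimilarIn X U V = Any (λ γ → Similar γ U V) X

-- Searching the splittings once and trying every γ at each leaf is much faster than deciding
-- ShuffleSquare γ W for each γ separately.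
Coverable : ∀ {k n} → List (Vec (Fin n) n) → Word k (n + n) → Set
Coverable X W = Even W → Unshuffles W (SimilarIn X)

coverable? : ∀ {k n} (X : List (Vec (Fin n) n)) (W : Word k (n + n)) → Dec (Coverable X W)
coverable? X W = even? W →-dec unshuffles? W λ U V → Any.any? (λ γ → similar? γ U V) X

coverable⇒covers : ∀ {k n} {X : List (Vec (Fin n) n)} (W : Word k (n + n)) → Coverable X W → Covers X W
coverable⇒covers W coverable even with coverable even
... | f , g , splitting , similarIn =
  Any.map (λ similar → unshuffles⇒shuffleSquare {W = W} (f , g , splitting , similar)) similarIn

coverable⇒covering : ∀ {k n} {X : List (Vec (Fin n) n)} → (∀ W → Coverable X W) → Covering k X
coverable⇒covering coverable W = coverable⇒covers W (coverable W)

-- Lower bounds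

AnyMatching : ∀ {k n m} → Word k n → Word k m → (Vec (Fin m) n → Set) → Set
AnyMatching []      V P = P []
AnyMatching (u ∷ U) V P = ∃ λ j → lookup V j ≡ u × AnyMatching U V (P ∘ (j ∷_))

anyMatching? : ∀ {k n m} (U : Word k n) (V : Word k m) {P : Vec (Fin m) n → Set} →
               Decidable P → Dec (AnyMatching U V P)
anyMatching? []      V P? = P? []
anyMatching? (u ∷ U) V P? = any? λ j → lookup V j ≟ u ×-dec anyMatching? U V (P? ∘ (j ∷_))

anyMatching⁻ : ∀ {k n m} {U : Word k n} {V : Word k m} {P : Vec (Fin m) n → Set} →
               AnyMatching U V P → ∃ λ γ → U ≡ map (lookup V) γ × P γ
anyMatching⁻ {U = []}    p                    = [] , refl , p
anyMatching⁻ {U = u ∷ U} (j , Vj≡u , matching) with anyMatching⁻ matching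
... | γ , U≡γV , p = j ∷ γ , cong₂ _∷_ (sym Vj≡u) U≡γV , p

anyMatching⁺ : ∀ {k n m} {U : Word k n} {V : Word k m} {P : Vec (Fin m) n → Set} γ →
               U ≡ map (lookup V) γ → P γ → AnyMatching U V P
anyMatching⁺ {U = []}    []      refl p = p
anyMatching⁺ {U = u ∷ U} (j ∷ γ) U≡γV p =
  j , sym (∷-injectiveˡ U≡γV) , anyMatching⁺ γ (∷-injectiveʳ U≡γV) p

Escapes : ∀ {k n} → List (Vec (Fin n) n) → Word k n → Word k n → Set
Escapes C U V = ∃ λ γ → IsPerm γ × Similar γ U V × γ ∉ C

-- A permutation γ with U = γ(V) is found by matching the letters of U against those of V,
-- which is far cheaper than running through all γ.
escapes? : ∀ {k n} (C : List (Vec (Fin n) n)) (U V : Word k n) → Dec (Escapes C U V)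
escapes? {n = n} C U V = map′ escapes (λ where
    (γ , perm , inj₁ U≡γV , γ∉C) → inj₁ (anyMatching⁺ γ U≡γV (perm , γ∉C))
    (γ , perm , inj₂ V≡γU , γ∉C) → inj₂ (anyMatching⁺ γ V≡γU (perm , γ∉C)))
  (anyMatching? U V outside? ⊎-dec anyMatching? V U outside?)
  where
  Outside : Vec (Fin n) n → Set
  Outside γ = IsPerm γ × γ ∉ C
  outside? : ∀ γ → Dec (Outside γ)
  outside? γ = isPerm? γ ×-dec ¬? (γ ∈? C)
  escapes : AnyMatching U V Outside ⊎ AnyMatching V U Outside → Escapes C U V
  escapes (inj₁ matching) with anyMatching⁻ {U = U} {V} {Outside} matching
  ... | γ , U≡γV , perm , γ∉C = γ , perm , inj₁ U≡γV , γ∉C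
  escapes (inj₂ matching) with anyMatching⁻ {U = V} {U} {Outside} matching
  ... | γ , V≡γU , perm , γ∉C = γ , perm , inj₂ V≡γU , γ∉C

squares⊆-by-search : ∀ {k n} {C : List (Vec (Fin n) n)} {W : Word k (n + n)} →
                     ¬ Unshuffles W (Escapes C) → ∀ γ → IsPerm γ → ShuffleSquare γ W → γ ∈ C
squares⊆-by-search {C = C} {W} none γ perm square with γ ∈? C
... | yes γ∈C = γ∈C
... | no γ∉C with shuffleSquare⇒unshuffles {W = W} square
...   | f , g , splitting , similar = contradiction (f , g , splitting , γ , perm , similar , γ∉C) none

noEscape? : ∀ {k n} (C : List (Vec (Fin n) n)) (W : Word k (n + n)) → Dec (¬ Unshuffles W (Escapes C))
noEscape? C W = ¬? (unshuffles? W (escapes? C))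

disjoint? : ∀ {n t} (candidates : Fin t → List (Vec (Fin n) n)) i j →
            Dec (All (λ γ → γ ∈ candidates j → i ≡ j) (candidates i))
disjoint? candidates i j = All.all? (λ γ → γ ∈? candidates j →-dec i ≟ j) (candidates i)

record Separating {k n t} (word : Fin t → Word k (n + n)) (candidates : Fin t → List (Vec (Fin n) n)) :
                  Set where
  field
    even     : ∀ i → Even (word i)
    squares⊆ : ∀ i γ → IsPerm γ → ShuffleSquare γ (word i) → γ ∈ candidates i
    disjoint : ∀ i j γ → γ ∈ candidates i → γ ∈ candidates j → i ≡ j

module _ {k n t} (word : Fin t → Word k (n + n)) (candidates : Fin t → List (Vec (Fin n) n)) where

  evenᵇ noEscapeᵇ disjointᵇ : Bool
  evenᵇ     = allFinᵇ λ i → isYes (even? (word i))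
  noEscapeᵇ = allFinᵇ λ i → isYes (noEscape? (candidates i) (word i))
  disjointᵇ = allFinᵇ λ i → allFinᵇ λ j → isYes (disjoint? candidates i j)

  separatingᵇ : Bool
  separatingᵇ = evenᵇ ∧ noEscapeᵇ ∧ disjointᵇ

  separatingᵇ-sound : T separatingᵇ → Separating word candidates
  separatingᵇ-sound checked = record
    { even     = toWitness-allFin (even? ∘ word) even
    ; squares⊆ = λ i → squares⊆-by-search {W = word i}
                         (toWitness-allFin (λ i → noEscape? (candidates i) (word i)) noEscape i)
    ; disjoint = λ i j γ → All.lookup
                   (toWitness-allFin (disjoint? candidates i) (allFinᵇ-sound _ disjoint i) j)
    }
    where
    even×rest         = Equivalence.to (T-∧ {evenᵇ}) checked
    even              = proj₁ even×rest
    noEscape×disjoint = Equivalence.to (T-∧ {noEscapeᵇ}) (proj₂ even×rest)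
    noEscape          = proj₁ noEscape×disjoint
    disjoint          = proj₂ noEscape×disjoint

covering-length≥ : ∀ {k n t} {word : Fin t → Word k (n + n)}
                   {candidates : Fin t → List (Vec (Fin n) n)} →
                   Separating word candidates → {X : List (Vec (Fin n) n)} →
                   All IsPerm X → Covering k X → t ≤ length X
covering-length≥ {word = word} {candidates} separating {X} perms covering =
  injective⇒≤ {f = Any.index ∘ square} injective
  where
  open Separating separating
  square : ∀ i → Any (λ γ → ShuffleSquare γ (word i)) X
  square i = covering (word i) (even i)
  candidate : ∀ i → Any.lookup (square i) ∈ candidates i
  candidate i = All.lookupWith (squares⊆ i _) perms (square i)
  injective : ∀ {i j} → Any.index (square i) ≡ Any.index (square j) → i ≡ j
  injective {i} {j} same =
    disjoint i j _ (candidate i) (subst (_∈ candidates j) (sym (cong (List.lookup X) same)) (candidate j))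

minCover : ∀ {k n} (X : List (Vec (Fin n) n)) → IsPermSet X → Covering k X →
           {word : Fin (length X) → Word k (n + n)} {candidates : Fin (length X) → List (Vec (Fin n) n)} →
           Separating word candidates → MinCover k n (length X)
minCover X isPermSet covering separating =
  (X , isPermSet , covering , refl) , λ Y (perms , _) → covering-length≥ separating perms

coveringSet2 : List (Vec (Fin 2) 2)
coveringSet2 =
  (0F ∷ 1F ∷ []) ∷ (1F ∷ 0F ∷ []) ∷ []

separatingWords2 : Vec (Word 2 (2 + 2)) 2
separatingWords2 =
  (0F ∷ 0F ∷ 1F ∷ 1F ∷ [])
  ∷ (0F ∷ 1F ∷ 1F ∷ 0F ∷ [])
  ∷ []

candidates2 : Vec (List (Vec (Fin 2) 2)) 2
candidates2 =
  ((0F ∷ 1F ∷ []) ∷ [])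
  ∷ ((1F ∷ 0F ∷ []) ∷ [])
  ∷ []

coveringSet3 : List (Vec (Fin 3) 3)
coveringSet3 =
  (0F ∷ 1F ∷ 2F ∷ [])
  ∷ (0F ∷ 2F ∷ 1F ∷ [])
  ∷ (1F ∷ 0F ∷ 2F ∷ [])
  ∷ (1F ∷ 2F ∷ 0F ∷ [])
  ∷ (2F ∷ 1F ∷ 0F ∷ [])
  ∷ []

separatingWords3 : Vec (Word 3 (3 + 3)) 5
separatingWords3 =
  (0F ∷ 0F ∷ 1F ∷ 1F ∷ 2F ∷ 2F ∷ [])
  ∷ (0F ∷ 0F ∷ 1F ∷ 2F ∷ 2F ∷ 1F ∷ [])
  ∷ (0F ∷ 1F ∷ 1F ∷ 0F ∷ 2F ∷ 2F ∷ [])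
  ∷ (0F ∷ 1F ∷ 1F ∷ 2F ∷ 2F ∷ 0F ∷ [])
  ∷ (0F ∷ 1F ∷ 2F ∷ 2F ∷ 1F ∷ 0F ∷ [])
  ∷ []

candidates3 : Vec (List (Vec (Fin 3) 3)) 5
candidates3 =
  ((0F ∷ 1F ∷ 2F ∷ []) ∷ [])
  ∷ ((0F ∷ 2F ∷ 1F ∷ []) ∷ [])
  ∷ ((1F ∷ 0F ∷ 2F ∷ []) ∷ [])
  ∷ ((1F ∷ 2F ∷ 0F ∷ []) ∷ (2F ∷ 0F ∷ 1F ∷ []) ∷ [])
  ∷ ((2F ∷ 1F ∷ 0F ∷ []) ∷ [])
  ∷ []

coveringSet4 : List (Vec (Fin 4) 4)
coveringSet4 =
  (0F ∷ 1F ∷ 2F ∷ 3F ∷ [])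
  ∷ (0F ∷ 1F ∷ 3F ∷ 2F ∷ [])
  ∷ (0F ∷ 2F ∷ 1F ∷ 3F ∷ [])
  ∷ (0F ∷ 2F ∷ 3F ∷ 1F ∷ [])
  ∷ (0F ∷ 3F ∷ 2F ∷ 1F ∷ [])
  ∷ (1F ∷ 0F ∷ 2F ∷ 3F ∷ [])
  ∷ (1F ∷ 0F ∷ 3F ∷ 2F ∷ [])
  ∷ (1F ∷ 2F ∷ 0F ∷ 3F ∷ [])
  ∷ (1F ∷ 2F ∷ 3F ∷ 0F ∷ [])
  ∷ (1F ∷ 3F ∷ 2F ∷ 0F ∷ [])
  ∷ (2F ∷ 1F ∷ 0F ∷ 3F ∷ [])
  ∷ (2F ∷ 1F ∷ 3F ∷ 0F ∷ [])
  ∷ (3F ∷ 1F ∷ 2F ∷ 0F ∷ [])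
  ∷ (3F ∷ 2F ∷ 1F ∷ 0F ∷ [])
  ∷ []

separatingWords4 : Vec (Word 4 (4 + 4)) 14
separatingWords4 =
  (0F ∷ 0F ∷ 1F ∷ 1F ∷ 2F ∷ 2F ∷ 3F ∷ 3F ∷ [])
  ∷ (0F ∷ 0F ∷ 1F ∷ 1F ∷ 2F ∷ 3F ∷ 3F ∷ 2F ∷ [])
  ∷ (0F ∷ 0F ∷ 1F ∷ 2F ∷ 2F ∷ 1F ∷ 3F ∷ 3F ∷ [])
  ∷ (0F ∷ 0F ∷ 1F ∷ 2F ∷ 2F ∷ 3F ∷ 3F ∷ 1F ∷ [])
  ∷ (0F ∷ 0F ∷ 1F ∷ 2F ∷ 3F ∷ 3F ∷ 2F ∷ 1F ∷ [])
  ∷ (0F ∷ 1F ∷ 1F ∷ 0F ∷ 2F ∷ 2F ∷ 3F ∷ 3F ∷ [])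
  ∷ (0F ∷ 1F ∷ 1F ∷ 0F ∷ 2F ∷ 3F ∷ 3F ∷ 2F ∷ [])
  ∷ (0F ∷ 1F ∷ 1F ∷ 2F ∷ 2F ∷ 0F ∷ 3F ∷ 3F ∷ [])
  ∷ (0F ∷ 1F ∷ 1F ∷ 2F ∷ 2F ∷ 3F ∷ 3F ∷ 0F ∷ [])
  ∷ (0F ∷ 1F ∷ 1F ∷ 2F ∷ 3F ∷ 3F ∷ 2F ∷ 0F ∷ [])
  ∷ (0F ∷ 1F ∷ 2F ∷ 2F ∷ 1F ∷ 0F ∷ 3F ∷ 3F ∷ [])
  ∷ (0F ∷ 1F ∷ 2F ∷ 2F ∷ 1F ∷ 3F ∷ 3F ∷ 0F ∷ [])
  ∷ (0F ∷ 1F ∷ 2F ∷ 2F ∷ 3F ∷ 3F ∷ 0F ∷ 1F ∷ [])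
  ∷ (0F ∷ 1F ∷ 2F ∷ 3F ∷ 3F ∷ 2F ∷ 1F ∷ 0F ∷ [])
  ∷ []

candidates4 : Vec (List (Vec (Fin 4) 4)) 14
candidates4 =
  ((0F ∷ 1F ∷ 2F ∷ 3F ∷ []) ∷ [])
  ∷ ((0F ∷ 1F ∷ 3F ∷ 2F ∷ []) ∷ [])
  ∷ ((0F ∷ 2F ∷ 1F ∷ 3F ∷ []) ∷ [])
  ∷ ((0F ∷ 2F ∷ 3F ∷ 1F ∷ []) ∷ (0F ∷ 3F ∷ 1F ∷ 2F ∷ []) ∷ [])
  ∷ ((0F ∷ 3F ∷ 2F ∷ 1F ∷ []) ∷ [])
  ∷ ((1F ∷ 0F ∷ 2F ∷ 3F ∷ []) ∷ [])
  ∷ ((1F ∷ 0F ∷ 3F ∷ 2F ∷ []) ∷ [])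
  ∷ ((1F ∷ 2F ∷ 0F ∷ 3F ∷ []) ∷ (2F ∷ 0F ∷ 1F ∷ 3F ∷ []) ∷ [])
  ∷ ((1F ∷ 2F ∷ 3F ∷ 0F ∷ []) ∷ (3F ∷ 0F ∷ 1F ∷ 2F ∷ []) ∷ [])
  ∷ ((1F ∷ 3F ∷ 2F ∷ 0F ∷ []) ∷ (3F ∷ 0F ∷ 2F ∷ 1F ∷ []) ∷ [])
  ∷ ((2F ∷ 1F ∷ 0F ∷ 3F ∷ []) ∷ [])
  ∷ ((2F ∷ 1F ∷ 3F ∷ 0F ∷ []) ∷ (3F ∷ 1F ∷ 0F ∷ 2F ∷ []) ∷ [])
  ∷ ((2F ∷ 3F ∷ 0F ∷ 1F ∷ []) ∷ (3F ∷ 1F ∷ 2F ∷ 0F ∷ []) ∷ [])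
  ∷ ((3F ∷ 2F ∷ 1F ∷ 0F ∷ []) ∷ [])
  ∷ []

covering2 : Covering 2 coveringSet2
covering2 = coverable⇒covering (toWitness-allVec (coverable? {k = 2} coveringSet2) _)

covering3 : Covering 3 coveringSet3
covering3 = coverable⇒covering (toWitness-allVec (coverable? {k = 3} coveringSet3) _)

covering4 : Covering 4 coveringSet4
covering4 = all-from-initial-0 invariant (all-initial-0-from-00-01 invariant (initial 0F _) (initial 1F _))
  where
  invariant = covers-renamingInvariant coveringSet4
  initial : ∀ b → T (allVecᵇ λ R → isYes (coverable? coveringSet4 (0F ∷ b ∷ R))) →
            ∀ R → Covers coveringSet4 (0F ∷ b ∷ R)
  initial b checked R =
    coverable⇒covers _ (toWitness-allVec (λ R → coverable? coveringSet4 (0F ∷ b ∷ R)) checked R)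

separating2 : Separating (lookup separatingWords2) (lookup candidates2)
separating2 = separatingᵇ-sound (lookup separatingWords2) (lookup candidates2) _

separating3 : Separating (lookup separatingWords3) (lookup candidates3)
separating3 = separatingᵇ-sound (lookup separatingWords3) (lookup candidates3) _

separating4 : Separating (lookup separatingWords4) (lookup candidates4)
separating4 = separatingᵇ-sound (lookup separatingWords4) (lookup candidates4) _

proposition7 : MinCover 2 2 2 × MinCover 3 3 5 × MinCover 4 4 14
proposition7 =
  minCover coveringSet2 (from-yes (isPermSet? coveringSet2)) covering2 separating2 ,
  minCover coveringSet3 (from-yes (isPermSet? coveringSet3)) covering3 separating3 ,
  minCover coveringSet4 (from-yes (isPermSet? coveringSet4)) covering4 separating4
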